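{- Let $m=2^a$ with $a\ge 1$. Any partial cyclic pair set $A\subseteq \mathbb{Z}_m$ has a unique maximal point.
   Context: Work in $\mathbb{Z}_m$ with $m=2^a$. For $x\in\mathbb{Z}_m$, the opposite point of $x$ is $x+m/2$, and $\{x,x+m/2\}$ is an opposite pair. A set $A\subseteq\mathbb{Z}_m$ is a partial cyclic pair set if it is non-empty and contains at most one point of each opposite pair. Order subsets of $\{0,1,\dots,m-1\}$ lexicographically: for distinct $A,B$, compare according to the first (smallest) element of the symmetric difference $A\triangle B$, i.e. which of the two sets contains it. For $x\in\mathbb{Z}_m$, let $A|_{[x,x+m)}=\{i\in\{0,\dots,m-1\}: x+i\in A\}$ (the set $A$ restricted to the cyclic interval of length $m$ starting at $x$, rotated to start at $0$). A point $x$ is a maximal point of $A$ if $A|_{[x,x+m)}$ is maximal in the lexicographic order among all $A|_{[y,y+m)}$, $y\in\mathbb{Z}_m$. -}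

module Defs where

open import Data.Nat using (ℕ; suc; _+_; _^_; _<_; NonZero)
open import Data.Nat.Properties using (m^n≢0)
open import Data.Nat.DivMod using (_%_; _/_; m%n<n)
open import Data.Fin using (Fin; toℕ; fromℕ<)
open import Data.Bool using (Bool; true; false)
open import Data.Product using (Σ; ∃; _×_)
open import Data.Sum using (_⊎_)
open import Relation.Binary.PropositionalEquality using (_≡_)
open import Relation.Nullary using (¬_)

modulus : ℕ → ℕ
modulus a = 2 ^ a

modulus-nonZero : ∀ a → NonZero (modulus a)
modulus-nonZero a = m^n≢0 2 a

-- Elements of ℤ_m are represented by Fin m; subsets of ℤ_m by their
-- (decidable) characteristic functions Fin m → Bool.
Subset : ℕ → Set
Subset m = Fin m → Bool

[_]mod : ∀ {a} → ℕ → Fin (modulus a)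
[_]mod {a} k = fromℕ< (m%n<n k (modulus a) {{modulus-nonZero a}})

_⊕_ : ∀ {a} → Fin (modulus a) → ℕ → Fin (modulus a)
_⊕_ {a} x k = [_]mod {a} (toℕ x + k)

opposite : ∀ {a} → Fin (modulus a) → Fin (modulus a)
opposite {a} x = _⊕_ {a} x (_/_ (modulus a) 2)

IsPartialCyclicPairSet : ∀ a → Subset (modulus a) → Set
IsPartialCyclicPairSet a A =
  (∃ λ x → A x ≡ true) ×
  (∀ x → ¬ (A x ≡ true × A (opposite {a} x) ≡ true))

_<lex_ : ∀ {m} → Subset m → Subset m → Set
_<lex_ {m} A B = ∃ λ (i : Fin m) →
  (∀ (j : Fin m) → toℕ j < toℕ i → A j ≡ B j) × A i ≡ false × B i ≡ true

_≤lex_ : ∀ {m} → Subset m → Subset m → Set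
A ≤lex B = (∀ j → A j ≡ B j) ⊎ (A <lex B)

restrict : ∀ a → Subset (modulus a) → Fin (modulus a) → Subset (modulus a)
restrict a A x i = A (_⊕_ {a} x (toℕ i))

IsMaximalPoint : ∀ a → Subset (modulus a) → Fin (modulus a) → Set
IsMaximalPoint a A x = ∀ y → restrict a A y ≤lex restrict a A x

-- If two points x < y of A were both maximal, the restrictions of A at x and y would coincide,
-- so A would be invariant under translation by d = y − x, with 0 < d < m. Since m is a power
-- of 2, some multiple of d is congruent to m/2 modulo m, so A would also be invariant under
-- x ↦ x + m/2, which is impossible for a non-empty set meeting each opposite pair at most once.
-- Existence of a maximal point is just finiteness of ℤ_m and totality of the lexicographic order.
module Submission where

open import Defs
open import Data.Nat using (ℕ; zero; suc; _+_; _*_; _∸_; _^_; _<_; _≤_; _≥_; s≤s; z<s; NonZero; _%_; _/_)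
open import Data.Nat.Properties
open import Data.Nat.DivMod using (m≡m%n+[m/n]*n; [m+n]%n≡m%n; m<n⇒m%n≡m; m*n/n≡m; m%n<n)
open import Data.Nat.Tactic.RingSolver using (solve-∀)
open import Data.Fin using (Fin; toℕ; fromℕ<)
import Data.Fin as Fin
open import Data.Fin.Properties using (toℕ-injective; fromℕ<-cong; fromℕ<-toℕ; toℕ-fromℕ<; toℕ<n)
open import Data.Vec.Functional using (head; tail)
open import Data.Bool using (Bool; true; false)
open import Data.Product using (∃; ∃₂; _×_; _,_; proj₁)
open import Data.Sum using (_⊎_; inj₁; inj₂)
open import Data.Empty using (⊥-elim)
open import Relation.Binary.PropositionalEquality
  using (_≡_; _≗_; refl; sym; trans; cong; subst; module ≡-Reasoning)
open import Relation.Binary.Definitions using (tri<; tri≈; tri>)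
open import Relation.Nullary using (¬_)
open import Function using (_∘_)

module _ {m : ℕ} where

  <lex-irrefl : {A : Subset m} → ¬ (A <lex A)
  <lex-irrefl (i , _ , Ai≡false , Ai≡true) with trans (sym Ai≡false) Ai≡true
  ... | ()

  <lex-trans : {A B C : Subset m} → A <lex B → B <lex C → A <lex C
  <lex-trans (i , A≗B , Ai , Bi) (j , B≗C , Bj , Cj) with <-cmp (toℕ i) (toℕ j)
  ... | tri< i<j _ _ = i , (λ k k<i → trans (A≗B k k<i) (B≗C k (<-trans k<i i<j))) ,
                       Ai , trans (sym (B≗C i i<j)) Bi
  ... | tri> _ _ j<i = j , (λ k k<j → trans (A≗B k (<-trans k<j j<i)) (B≗C k k<j)) ,
                       trans (A≗B j j<i) Bj , Cj
  ... | tri≈ _ i≡j _ with toℕ-injective i≡j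
  ... | refl with trans (sym Bi) Bj
  ... | ()

  <lex-respˡ-≗ : {A B C : Subset m} → A ≗ B → B <lex C → A <lex C
  <lex-respˡ-≗ A≗B (i , B≗C , Bi , Ci) =
    i , (λ k k<i → trans (A≗B k) (B≗C k k<i)) , trans (A≗B i) Bi , Ci

  <lex-respʳ-≗ : {A B C : Subset m} → B ≗ C → A <lex B → A <lex C
  <lex-respʳ-≗ B≗C (i , A≗B , Ai , Bi) =
    i , (λ k k<i → trans (A≗B k k<i) (B≗C k)) , Ai , trans (sym (B≗C i)) Bi

  ≤lex-trans : {A B C : Subset m} → A ≤lex B → B ≤lex C → A ≤lex C
  ≤lex-trans (inj₁ A≗B) (inj₁ B≗C) = inj₁ (λ j → trans (A≗B j) (B≗C j))
  ≤lex-trans (inj₁ A≗B) (inj₂ B<C) = inj₂ (<lex-respˡ-≗ A≗B B<C)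
  ≤lex-trans (inj₂ A<B) (inj₁ B≗C) = inj₂ (<lex-respʳ-≗ B≗C A<B)
  ≤lex-trans (inj₂ A<B) (inj₂ B<C) = inj₂ (<lex-trans A<B B<C)

  ≤lex-antisym : {A B : Subset m} → A ≤lex B → B ≤lex A → A ≗ B
  ≤lex-antisym (inj₁ A≗B) _          = A≗B
  ≤lex-antisym (inj₂ _)   (inj₁ B≗A) = λ j → sym (B≗A j)
  ≤lex-antisym (inj₂ A<B) (inj₂ B<A) = ⊥-elim (<lex-irrefl (<lex-trans A<B B<A))

module _ {m : ℕ} {A B : Subset (suc m)} (head≡ : head A ≡ head B) where

  <lex-tail : tail A <lex tail B → A <lex B
  <lex-tail (i , A≗B , Ai , Bi) = Fin.suc i , below , Ai , Bi
    where
    below : ∀ j → toℕ j < toℕ (Fin.suc i) → A j ≡ B j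
    below Fin.zero    _         = head≡
    below (Fin.suc j) (s≤s j<i) = A≗B j j<i

  ≤lex-tail : tail A ≤lex tail B → A ≤lex B
  ≤lex-tail (inj₁ A≗B) = inj₁ λ { Fin.zero → head≡ ; (Fin.suc j) → A≗B j }
  ≤lex-tail (inj₂ A<B) = inj₂ (<lex-tail A<B)

≤lex-total : ∀ {m} (A B : Subset m) → A ≤lex B ⊎ B ≤lex A
≤lex-total {zero}  A B = inj₁ (inj₁ λ ())
≤lex-total {suc m} A B = compare (head A) (head B) refl refl
  where
  compareTails : head A ≡ head B → A ≤lex B ⊎ B ≤lex A
  compareTails head≡ with ≤lex-total (tail A) (tail B)
  ... | inj₁ tA≤tB = inj₁ (≤lex-tail head≡ tA≤tB)
  ... | inj₂ tB≤tA = inj₂ (≤lex-tail (sym head≡) tB≤tA)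
  compare : ∀ a b → head A ≡ a → head B ≡ b → A ≤lex B ⊎ B ≤lex A
  compare false true  hA hB = inj₁ (inj₂ (Fin.zero , (λ _ ()) , hA , hB))
  compare true  false hA hB = inj₂ (inj₂ (Fin.zero , (λ _ ()) , hB , hA))
  compare false false hA hB = compareTails (trans hA (sym hB))
  compare true  true  hA hB = compareTails (trans hA (sym hB))

≤lex-maximum : ∀ {m n} → Fin n → (f : Fin n → Subset m) → ∃ λ x → ∀ y → f y ≤lex f x
≤lex-maximum {n = suc zero}    _ f = Fin.zero , λ { Fin.zero → inj₁ (λ _ → refl) }
≤lex-maximum {n = suc (suc n)} _ f with ≤lex-maximum Fin.zero (tail f)
... | x , max-tail with ≤lex-total (head f) (f (Fin.suc x))
... | inj₁ head≤ = Fin.suc x , λ { Fin.zero → head≤ ; (Fin.suc y) → max-tail y }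
... | inj₂ ≤head = Fin.zero , λ { Fin.zero → inj₁ (λ _ → refl)
                                ; (Fin.suc y) → ≤lex-trans (max-tail y) ≤head }

even-or-odd : ∀ n → (∃ λ e → n ≡ 2 * e) ⊎ (∃ λ o → n ≡ suc (2 * o))
even-or-odd 0 = inj₁ (0 , refl)
even-or-odd 1 = inj₂ (0 , refl)
even-or-odd (suc (suc n)) with even-or-odd n
... | inj₁ (e , refl) = inj₁ (suc e , cong suc (sym (+-suc e (e + 0))))
... | inj₂ (o , refl) = inj₂ (suc o , cong suc (cong suc (sym (+-suc o (o + 0)))))

*-double : ∀ k e p c → k * e ≡ p + c * (2 * p) → k * (2 * e) ≡ 2 * p + c * (2 * (2 * p))
*-double k e p c ke = begin
  k * (2 * e)               ≡⟨ swap k e ⟩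
  2 * (k * e)               ≡⟨ cong (2 *_) ke ⟩
  2 * (p + c * (2 * p))     ≡⟨ distrib p c ⟩
  2 * p + c * (2 * (2 * p)) ∎
  where
  open ≡-Reasoning
  swap : ∀ k e → k * (2 * e) ≡ 2 * (k * e)
  swap = solve-∀
  distrib : ∀ p c → 2 * (p + c * (2 * p)) ≡ 2 * p + c * (2 * (2 * p))
  distrib = solve-∀

-- The witness is k = 2^(a ∸ v) where d = 2^v (2o + 1).
multiple-≡-half : ∀ a d → 0 < d → d < 2 ^ suc a → ∃₂ λ k c → k * d ≡ 2 ^ a + c * 2 ^ suc a
multiple-≡-half a d 0<d d<2^[1+a] with even-or-odd d
multiple-≡-half a _ () _ | inj₁ (zero , refl)
... | inj₁ (e@(suc _) , refl) = halve a (*-cancelˡ-< 2 e (2 ^ a) d<2^[1+a])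
  where
  halve : ∀ a → e < 2 ^ a → ∃₂ λ k c → k * (2 * e) ≡ 2 ^ a + c * 2 ^ suc a
  halve zero    (s≤s ())
  halve (suc a) e<2^[1+a] with multiple-≡-half a e z<s e<2^[1+a]
  ... | k , c , ke = k , c , *-double k e (2 ^ a) c ke
... | inj₂ (o , refl) = 2 ^ a , o , odd (2 ^ a) o
  where
  odd : ∀ p o → p * suc (2 * o) ≡ p + o * (2 * p)
  odd = solve-∀

2^[1+n]/2≡2^n : ∀ n → 2 ^ suc n / 2 ≡ 2 ^ n
2^[1+n]/2≡2^n n = trans (cong (_/ 2) (*-comm 2 (2 ^ n))) (m*n/n≡m (2 ^ n) 2)

multiple-≡-half-mod : ∀ a d → 0 < d → d < 2 ^ a → ∃₂ λ k c → k * d ≡ 2 ^ a / 2 + c * 2 ^ a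
multiple-≡-half-mod zero    d 0<d d<1 = ⊥-elim (<-irrefl refl (<-≤-trans 0<d (≤-pred d<1)))
multiple-≡-half-mod (suc a) d 0<d d<2^[1+a] rewrite 2^[1+n]/2≡2^n a =
  multiple-≡-half a d 0<d d<2^[1+a]

module _ {X : Set} (f : ℕ → X) where

  Periodic : ℕ → Set
  Periodic d = ∀ n → f (n + d) ≡ f n

  periodic-* : ∀ {d} → Periodic d → ∀ k → Periodic (k * d)
  periodic-* p zero    n = cong f (+-identityʳ n)
  periodic-* {d} p (suc k) n = begin
    f (n + (d + k * d)) ≡⟨ cong f (trans (cong (n +_) (+-comm d (k * d))) (sym (+-assoc n (k * d) d))) ⟩
    f (n + k * d + d)   ≡⟨ p (n + k * d) ⟩
    f (n + k * d)       ≡⟨ periodic-* p k n ⟩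
    f n                 ∎
    where open ≡-Reasoning

  periodic-cancel : ∀ {M p} c → Periodic M → Periodic (p + c * M) → Periodic p
  periodic-cancel {M} {p} c pM p+cM n = begin
    f (n + p)           ≡⟨ periodic-* pM c (n + p) ⟨
    f (n + p + c * M)   ≡⟨ cong f (+-assoc n p (c * M)) ⟩
    f (n + (p + c * M)) ≡⟨ p+cM n ⟩
    f n                 ∎
    where open ≡-Reasoning

  periodic-% : ∀ {M} .{{_ : NonZero M}} → Periodic M → ∀ z i → f (z + i) ≡ f (z + i % M)
  periodic-% {M} pM z i = begin
    f (z + i)                     ≡⟨ cong (λ t → f (z + t)) (m≡m%n+[m/n]*n i M) ⟩
    f (z + (i % M + i / M * M))   ≡⟨ cong f (sym (+-assoc z (i % M) (i / M * M))) ⟩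
    f (z + i % M + i / M * M)     ≡⟨ periodic-* pM (i / M) (z + i % M) ⟩
    f (z + i % M)                 ∎
    where open ≡-Reasoning

  translation-invariant⇒periodic : ∀ {M x d} → Periodic M → x ≤ M →
                                   (∀ i → f (x + i) ≡ f (x + d + i)) → Periodic d
  translation-invariant⇒periodic {M} {x} {d} pM x≤M inv n = begin
    f (n + d)         ≡⟨ pM (n + d) ⟨
    f (n + d + M)     ≡⟨ cong f (move n d M) ⟩
    f (d + (n + M))   ≡⟨ cong (λ t → f (d + t)) x+i≡n+M ⟨
    f (d + (x + i))   ≡⟨ cong f (move x d i) ⟨
    f (x + d + i)     ≡⟨ inv i ⟨
    f (x + i)         ≡⟨ cong f x+i≡n+M ⟩
    f (n + M)         ≡⟨ pM n ⟩
    f n               ∎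
    where
    open ≡-Reasoning
    i : ℕ
    i = n + M ∸ x
    x+i≡n+M : x + i ≡ n + M
    x+i≡n+M = m+[n∸m]≡n (≤-trans x≤M (m≤n+m M n))
    move : ∀ a b c → a + b + c ≡ b + (a + c)
    move = solve-∀

module _ (a : ℕ) (A : Subset (modulus a)) where

  private
    M : ℕ
    M = modulus a
    instance
      M≢0 : NonZero M
      M≢0 = modulus-nonZero a

  extend : ℕ → Bool
  extend n = A ([_]mod {a} n)

  extend-periodic : Periodic extend M
  extend-periodic n = cong A (fromℕ<-cong _ _ ([m+n]%n≡m%n n M) (m%n<n (n + M) M) (m%n<n n M))

  extend-toℕ : ∀ z → extend (toℕ z) ≡ A z
  extend-toℕ z = cong A (trans (fromℕ<-cong _ _ (m<n⇒m%n≡m (toℕ<n z)) _ (toℕ<n z)) (fromℕ<-toℕ z _))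

  extend-restrict : ∀ x i → extend (toℕ x + i) ≡ restrict a A x (fromℕ< (m%n<n i M))
  extend-restrict x i = trans (periodic-% extend extend-periodic (toℕ x) i)
                              (cong (λ t → extend (toℕ x + t)) (sym (toℕ-fromℕ< _)))

  restrict-≗⇒periodic : ∀ {x y} → toℕ x ≤ toℕ y → restrict a A x ≗ restrict a A y →
                        Periodic extend (toℕ y ∸ toℕ x)
  restrict-≗⇒periodic {x} {y} x≤y x≗y =
    translation-invariant⇒periodic extend extend-periodic (<⇒≤ (toℕ<n x)) λ i → begin
      extend (toℕ x + i)                      ≡⟨ extend-restrict x i ⟩
      restrict a A x (fromℕ< (m%n<n i M))     ≡⟨ x≗y _ ⟩
      restrict a A y (fromℕ< (m%n<n i M))     ≡⟨ extend-restrict y i ⟨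
      extend (toℕ y + i)                      ≡⟨ cong (λ t → extend (t + i)) (m+[n∸m]≡n x≤y) ⟨
      extend (toℕ x + (toℕ y ∸ toℕ x) + i)    ∎
    where open ≡-Reasoning

  not-periodic-half : IsPartialCyclicPairSet a A → ¬ Periodic extend (M / 2)
  not-periodic-half ((z , Az) , no-pair) per =
    no-pair z (Az , trans (per (toℕ z)) (trans (extend-toℕ z) Az))

  module _ (pcs : IsPartialCyclicPairSet a A) where

    not-periodic : ∀ {d} → 0 < d → d < M → ¬ Periodic extend d
    not-periodic {d} 0<d d<M per with multiple-≡-half-mod a d 0<d d<M
    ... | k , c , kd≡ = not-periodic-half pcs
      (periodic-cancel extend c extend-periodic (subst (Periodic extend) kd≡ (periodic-* extend per k)))

    restrict-distinct : ∀ {x y} → toℕ x < toℕ y → ¬ restrict a A x ≗ restrict a A y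
    restrict-distinct {x} {y} x<y = not-periodic (m<n⇒0<n∸m x<y)
      (≤-<-trans (m∸n≤m (toℕ y) (toℕ x)) (toℕ<n y)) ∘ restrict-≗⇒periodic (<⇒≤ x<y)

    restrict-injective : ∀ {x y} → restrict a A x ≗ restrict a A y → x ≡ y
    restrict-injective {x} {y} x≗y with <-cmp (toℕ x) (toℕ y)
    ... | tri≈ _ x≡y _ = toℕ-injective x≡y
    ... | tri< x<y _ _ = ⊥-elim (restrict-distinct x<y x≗y)
    ... | tri> _ _ y<x = ⊥-elim (restrict-distinct y<x (sym ∘ x≗y))

lemma11 : (a : ℕ) → a ≥ 1 → (A : Subset (modulus a)) → IsPartialCyclicPairSet a A →
    ∃ λ x → IsMaximalPoint a A x × (∀ y → IsMaximalPoint a A y → y ≡ x)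
lemma11 a _ A pcs with ≤lex-maximum (proj₁ (proj₁ pcs)) (restrict a A)
... | x , max-x = x , max-x , λ y max-y →
  restrict-injective a A pcs (≤lex-antisym (max-x y) (max-y x))
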